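{- Let $\phi$ be an instance of \textsc{Max (2,3)-SAT} with $n$ variables and let $T_\phi$ be the \textsc{Tournament Value Maximization} instance constructed from $\phi$ as described in the context (the 0/1-valued construction). If $\phi$ admits an assignment satisfying at least $k$ clauses, then $T_\phi$ has a seeding whose tournament value is at least $k+n$.
   Context: Tournament model: players are natural numbers forming a set $N$ with $|N|=2^{n'}$; player $i$ beats $j$ iff $i>j$. A seeding is a bijection $\sigma:N\to\{1,\dots,|N|\}$. In round $r=1,\dots,n'$, for each block of $2^r$ consecutive seed positions $\{(t-1)2^r+1,\dots,t2^r\}$, the winner $i_1$ of the first half (its strongest player) plays the winner $i_2$ of the second half with game value $v(i_1,i_2,r)$; the block winner is $\max(i_1,i_2)$. The tournament value is the sum of all game values. \textsc{Max (2,3)-SAT}: a Boolean formula $\phi$ in which each clause has exactly two literals and each variable appears in at most three clauses; the goal is to maximize the number of satisfied clauses. For each variable $x$, fix an order of its (at most three) appearances in clauses, called its 1st, 2nd, 3rd appearance. Construction of $T_\phi$ from $\phi$ with variables $x_1,\dots,x_n$ and clauses $c_1,\dots,c_m$: for each variable $x$ create variable players $x,x^T,x^F$; for each clause $c$ create a clause player $c$; let $n'$ be the smallest integer with $16n\le 2^{n'}$, $p=2^{n'}-16n$, and create dummy players $f_1,\dots,f_{13n+p-m}$. The strength order is $x_1>x_1^T>x_1^F>x_2>\dots>x_n>x_n^T>x_n^F>c_1>\dots>c_m>f_1>\dots>f_{13n+p-m}$. The game-value function is symmetric ($v(a,b,r)=v(b,a,r)$) and given by: $v(x,x^T,1)=v(x,x^F,1)=1$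 for each variable $x$; if the $j$th appearance of variable $x$ is in clause $c$, then $v(c,x^T,j)=1$ if $x$ appears non-negated in $c$, and $v(c,x^F,j)=1$ if $x$ appears negated in $c$; all other values $v(a,b,r)$ for $r\in\{1,\dots,n'\}$ are $0$. -}

module Defs where

open import Data.Nat using (ℕ; zero; suc; _+_; _*_; _∸_; _^_; _≤_; _<_; _≤ᵇ_)
import Data.Nat.Properties as ℕP
open import Data.Bool using (Bool; true; false; not; if_then_else_)
import Data.Bool.Properties as BP
open import Data.Fin using (Fin; toℕ; _↑ˡ_; _↑ʳ_; inject₁)
  renaming (zero to fzero; suc to fsuc)
import Data.Fin.Properties as FP
open import Data.Product using (Σ; ∃; _×_; _,_; proj₁; proj₂)
import Data.Product.Properties as PP
open import Data.List using (List; length; filter; allFin; concatMap; map)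
open import Relation.Binary.PropositionalEquality using (_≡_)
open import Relation.Nullary using (Dec; yes; no)
open import Relation.Nullary.Decidable using (⌊_⌋; _×-dec_)
open import Function.Bundles using (_↔_; Inverse)

-- A literal: a variable together with its polarity
-- (true = non-negated, false = negated).
Lit : ℕ → Set
Lit n = Fin n × Bool

Formula : ℕ → ℕ → Set
Formula n m = Fin m → Fin 2 → Lit n

Occ : ℕ → Set
Occ m = Fin m × Fin 2

allOcc : (m : ℕ) → List (Occ m)
allOcc m = concatMap (λ c → map (λ p → (c , p)) (allFin 2)) (allFin m)

occVar : ∀ {n m} → Formula n m → Occ m → Fin n
occVar φ (c , p) = proj₁ (φ c p)

appearances : ∀ {n m} → Formula n m → Fin n → ℕ
appearances φ x = length (filter (λ o → occVar φ o FP.≟ x) (allOcc _))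

IsMax23 : ∀ {n m} → Formula n m → Set
IsMax23 {n} φ = (x : Fin n) → appearances φ x ≤ 3

-- A fixed order of the appearances of every variable: rank o = j means
-- o is the (j+1)-th appearance of its variable.
record AppearanceOrder {n m : ℕ} (φ : Formula n m) : Set where
  field
    rank      : Occ m → Fin 3
    injective : (o o' : Occ m) → occVar φ o ≡ occVar φ o' →
                rank o ≡ rank o' → o ≡ o'
    initial   : (o : Occ m) (j : Fin 2) → rank o ≡ fsuc j →
                Σ (Occ m) λ o' → occVar φ o' ≡ occVar φ o × rank o' ≡ inject₁ j

Assignment : ℕ → Set
Assignment n = Fin n → Bool

litSat : ∀ {n} → Assignment n → Lit n → Set
litSat a (x , pol) = a x ≡ pol

clauseSat : ∀ {n m} → Assignment n → Formula n m → Fin m → Set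
clauseSat a φ c = ∃ λ (p : Fin 2) → litSat a (φ c p)

clauseSat? : ∀ {n m} (a : Assignment n) (φ : Formula n m) (c : Fin m) →
             Dec (clauseSat a φ c)
clauseSat? a φ c = FP.any? (λ p → a (proj₁ (φ c p)) BP.≟ proj₂ (φ c p))

numSat : ∀ {n m} → Assignment n → Formula n m → ℕ
numSat {m = m} a φ = length (filter (clauseSat? a φ) (allFin m))

data Player (n m d : ℕ) : Set where
  vx vT vF : Fin n → Player n m d
  cl       : Fin m → Player n m d
  dm       : Fin d → Player n m d

-- The natural number identifying each player; it realises the strength
-- order x₁ > x₁ᵀ > x₁ᶠ > x₂ > … > xₙᶠ > c₁ > … > c_m > f₁ > … > f_d
-- (index 0 of Fin corresponds to subscript 1).
strength : ∀ {n m d} → Player n m d → ℕ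
strength {n} {m} {d} (vx i) = d + m + 3 * (n ∸ suc (toℕ i)) + 3
strength {n} {m} {d} (vT i) = d + m + 3 * (n ∸ suc (toℕ i)) + 2
strength {n} {m} {d} (vF i) = d + m + 3 * (n ∸ suc (toℕ i)) + 1
strength {n} {m} {d} (cl j) = d + (m ∸ toℕ j)
strength {n} {m} {d} (dm k) = d ∸ toℕ k

winner : ∀ {n m d} → Player n m d → Player n m d → Player n m d
winner a b = if strength b ≤ᵇ strength a then a else b

[_] : ∀ {P : Set} → Dec P → ℕ
[ yes _ ] = 1
[ no  _ ] = 0

-- does clause c contain, as the appearance of rank r (round r, 1-based),
-- the variable x with polarity pol?
clauseApp? : ∀ {n m} (φ : Formula n m) (O : AppearanceOrder φ)
             (c : Fin m) (x : Fin n) (pol : Bool) (r : ℕ) →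
             Dec (∃ λ (p : Fin 2) → φ c p ≡ (x , pol) ×
                   suc (toℕ (AppearanceOrder.rank O (c , p))) ≡ r)
clauseApp? φ O c x pol r =
  FP.any? (λ p → PP.≡-dec FP._≟_ BP._≟_ (φ c p) (x , pol)
                 ×-dec (suc (toℕ (AppearanceOrder.rank O (c , p))) ℕP.≟ r))

gameValue : ∀ {n m d} (φ : Formula n m) (O : AppearanceOrder φ) →
            Player n m d → Player n m d → ℕ → ℕ
gameValue φ O (vx x) (vT y) 1 = [ x FP.≟ y ]
gameValue φ O (vT y) (vx x) 1 = [ x FP.≟ y ]
gameValue φ O (vx x) (vF y) 1 = [ x FP.≟ y ]
gameValue φ O (vF y) (vx x) 1 = [ x FP.≟ y ]
gameValue φ O (cl c) (vT x) r = [ clauseApp? φ O c x true r ]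
gameValue φ O (vT x) (cl c) r = [ clauseApp? φ O c x true r ]
gameValue φ O (cl c) (vF x) r = [ clauseApp? φ O c x false r ]
gameValue φ O (vF x) (cl c) r = [ clauseApp? φ O c x false r ]
gameValue φ O _      _      _ = 0

leftHalf : ∀ r → Fin (2 ^ r) → Fin (2 ^ suc r)
leftHalf r i = i ↑ˡ (2 ^ r + 0)

rightHalf : ∀ r → Fin (2 ^ r) → Fin (2 ^ suc r)
rightHalf r i = (2 ^ r) ↑ʳ (i ↑ˡ 0)

playBlock : ∀ {P : Set} → (P → P → P) → (P → P → ℕ → ℕ) →
            (r : ℕ) → (Fin (2 ^ r) → P) → P × ℕ
playBlock win v zero    f = f fzero , 0
playBlock win v (suc r) f =
  let L = playBlock win v r (λ i → f (leftHalf r i))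
      R = playBlock win v r (λ i → f (rightHalf r i))
  in  win (proj₁ L) (proj₁ R) ,
      (proj₂ L + proj₂ R) + v (proj₁ L) (proj₁ R) (suc r)

IsRoundCount : ℕ → ℕ → Set
IsRoundCount n n' = (16 * n ≤ 2 ^ n') × ((r : ℕ) → r < n' → 2 ^ r < 16 * n)

numDummies : (n m n' : ℕ) → ℕ
numDummies n m n' = 13 * n + (2 ^ n' ∸ 16 * n) ∸ m

-- A seeding: a bijection σ from the players to the 2^n' seed positions
-- (Fin (2^n') position i stands for seed i+1).
Seeding : (n m n' : ℕ) → Set
Seeding n m n' = Player n m (numDummies n m n') ↔ Fin (2 ^ n')

tournamentValue : ∀ {n m} (n' : ℕ) (φ : Formula n m) (O : AppearanceOrder φ) →
                  Seeding n m n' → ℕ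
tournamentValue n' φ O σ =
  proj₂ (playBlock winner (gameValue φ O) n' (Inverse.from σ))

{-# OPTIONS --safe #-}
module Submission where

-- Every variable t gets a block of 16 consecutive seeds.  Seat 0 holds the
-- literal player ℓ that the assignment makes true, seats 14 and 15 hold t and the other
-- literal (a round-1 game worth 1), and the remaining 13 "low" seats hold clause and dummy
-- players, all weaker than every literal player.  Each clause c picks a literal satisfied
-- by the assignment (if there is one); if that is the j-th appearance of t, then c sits on
-- the seat of ℓ's round-j opponent, whose sub-block contains only dummies besides c.  So ℓ
-- meets c in round j, which is worth 1 when c is satisfied.  Distinct clauses pick distinct
-- (variable, appearance) pairs, the dummies fill exactly the remaining low seats, and the
-- tournament value is at least the sum of the values of the n blocks: #satisfied + n.

open import Defs
open import Data.Bool using (Bool; true; false; not)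
import Data.Bool.Properties as Bool
open import Data.Fin using (Fin; toℕ; _↑ˡ_; _↑ʳ_; combine; cast; inject≤; punchIn; punchOut; #_)
  renaming (suc to fsuc)
import Data.Fin.Properties as FP
open import Data.Fin.Patterns using (0F; 1F; 2F; 3F; 4F; 5F; 6F)
open import Data.Fin.Permutation as Perm using (Permutation; _⟨$⟩ʳ_)
open import Data.List using (length; filter; tabulate)
open import Data.Nat using (ℕ; zero; suc; _+_; _*_; _∸_; _^_; _≤_; _<_; _≤ᵇ_; z≤n; s≤s; _≤?_)
open import Data.Nat.Properties
open import Algebra.Properties.CommutativeMonoid.Sum +-0-commutativeMonoid
  using (sum; sum-syntax; sum-cong-≗; ∑-permute; ∑-distrib-+)
open import Data.Nat.Tactic.RingSolver using (solve-∀)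
open import Data.Product using (Σ; ∃; _×_; _,_; proj₁; proj₂; uncurry; map₂)
open import Data.Product.Algebra using (×-comm; ×-distribˡ-⊎)
open import Data.Product.Function.NonDependent.Propositional using (_×-↔_)
open import Data.Sum using (_⊎_; inj₁; inj₂)
open import Data.Sum.Algebra using (⊎-comm; ⊎-assoc)
open import Data.Sum.Function.Propositional using (_⊎-↔_)
open import Data.Sum.Properties using (inj₁-injective)
open import Function using (_∘_; id)
open import Function.Bundles using (_↔_; Inverse; Injection; mk↔ₛ′)
open import Function.Definitions using (Injective)
open import Function.Properties.Inverse using (↔-refl; ↔-sym; ↔-trans; ↔⇒↣)
open import Level using (0ℓ)
open import Relation.Binary.PropositionalEquality hiding ([_])
open import Relation.Nullary using (Dec; yes; no; contradiction)
open import Relation.Unary using (Pred; Decidable)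

∑-splitAt : ∀ a b (f : Fin (a + b) → ℕ) →
            ∑[ i < a + b ] f i ≡ ∑[ i < a ] f (i ↑ˡ b) + ∑[ j < b ] f (a ↑ʳ j)
∑-splitAt zero    b f = refl
∑-splitAt (suc a) b f =
  trans (cong (f 0F +_) (∑-splitAt a b (f ∘ fsuc))) (sym (+-assoc (f 0F) _ _))

∑-combine : ∀ a b (f : Fin (a * b) → ℕ) →
            ∑[ k < a * b ] f k ≡ ∑[ i < a ] ∑[ j < b ] f (combine i j)
∑-combine zero    b f = refl
∑-combine (suc a) b f = trans (∑-splitAt b (a * b) f)
  (cong (∑[ j < b ] f (j ↑ˡ a * b) +_) (∑-combine a b (f ∘ (b ↑ʳ_))))

∑-mono-≤ : ∀ {k} {f g : Fin k → ℕ} → (∀ i → f i ≤ g i) → sum f ≤ sum g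
∑-mono-≤ {zero}  f≤g = z≤n
∑-mono-≤ {suc k} f≤g = +-mono-≤ (f≤g 0F) (∑-mono-≤ (f≤g ∘ fsuc))

∑-ones : ∀ k → ∑[ i < k ] 1 ≡ k
∑-ones zero    = refl
∑-ones (suc k) = cong suc (∑-ones k)

length-filter-tabulate : ∀ {A : Set} {P : Pred A _} (P? : Decidable P) {k} (f : Fin k → A) →
                         length (filter P? (tabulate f)) ≡ ∑[ i < k ] [ P? (f i) ]
length-filter-tabulate P? {zero}  f = refl
length-filter-tabulate P? {suc k} f with P? (f 0F)
... | yes _ = cong suc (length-filter-tabulate P? (f ∘ fsuc))
... | no  _ = length-filter-tabulate P? (f ∘ fsuc)

indicator-yes : ∀ {P : Set} (P? : Dec P) → P → [ P? ] ≡ 1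
indicator-yes (yes _) _ = refl
indicator-yes (no ¬p) p = contradiction p ¬p

extend-injection : ∀ {m N} (g : Fin m → Fin N) → Injective _≡_ _≡_ g →
                   Σ (Permutation (m + (N ∸ m)) N) λ π → ∀ i → π ⟨$⟩ʳ (i ↑ˡ (N ∸ m)) ≡ g i
extend-injection {zero}          g _     = Perm.id , λ ()
extend-injection {suc m} {zero}  g _     = contradiction (g 0F) FP.¬Fin0
extend-injection {suc m} {suc N} g g-inj = Perm.insert 0F (g 0F) π , extends
  where
  g0≢ : ∀ i → g 0F ≢ g (fsuc i)
  g0≢ i eq with () ← g-inj eq
  g′ : Fin m → Fin N
  g′ i = punchOut (g0≢ i)
  g′-injective : Injective _≡_ _≡_ g′
  g′-injective eq = FP.suc-injective (g-inj (FP.punchOut-injective (g0≢ _) (g0≢ _) eq))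
  π = proj₁ (extend-injection g′ g′-injective)
  π-extends = proj₂ (extend-injection g′ g′-injective)
  extends : ∀ i → Perm.insert 0F (g 0F) π ⟨$⟩ʳ (i ↑ˡ (N ∸ m)) ≡ g i
  extends 0F       = refl
  extends (fsuc i) = begin
    Perm.insert 0F (g 0F) π ⟨$⟩ʳ punchIn 0F (i ↑ˡ (N ∸ m)) ≡⟨ Perm.insert-punchIn 0F (g 0F) π _ ⟩
    punchIn (g 0F) (π ⟨$⟩ʳ (i ↑ˡ (N ∸ m)))               ≡⟨ cong (punchIn (g 0F)) (π-extends i) ⟩
    punchIn (g 0F) (g′ i)                                  ≡⟨ FP.punchIn-punchOut (g0≢ i) ⟩
    g (fsuc i)                                             ∎
    where open ≡-Reasoning

∑-∘-injective-≤ : ∀ {m N} (g : Fin m → Fin N) → Injective _≡_ _≡_ g →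
                  (h : Fin N → ℕ) → ∑[ i < m ] h (g i) ≤ ∑[ k < N ] h k
∑-∘-injective-≤ {m} {N} g g-inj h = begin
  ∑[ i < m ] h (g i)
    ≡⟨ sum-cong-≗ (cong h ∘ extends) ⟨
  ∑[ i < m ] h (π ⟨$⟩ʳ (i ↑ˡ (N ∸ m)))
    ≤⟨ m≤m+n _ _ ⟩
  ∑[ i < m ] h (π ⟨$⟩ʳ (i ↑ˡ (N ∸ m))) + ∑[ j < N ∸ m ] h (π ⟨$⟩ʳ (m ↑ʳ j))
    ≡⟨ ∑-splitAt m (N ∸ m) (h ∘ (π ⟨$⟩ʳ_)) ⟨
  ∑[ x < m + (N ∸ m) ] h (π ⟨$⟩ʳ x)
    ≡⟨ ∑-permute h π ⟨
  ∑[ k < N ] h k ∎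
  where
  open ≤-Reasoning
  π = proj₁ (extend-injection g g-inj)
  extends = proj₂ (extend-injection g g-inj)

16≤2^n⇒∃[s]s+4≡n : ∀ n → 16 ≤ 2 ^ n → ∃ λ s → s + 4 ≡ n
16≤2^n⇒∃[s]s+4≡n n 16≤2^n with 4 ≤? n
... | yes 4≤n = let s , 4+s≡n = m≤n⇒∃[o]m+o≡n 4≤n in s , trans (+-comm s 4) 4+s≡n
... | no  4≰n = contradiction 16≤2^n (<⇒≱ (^-monoʳ-< 2 (s≤s (s≤s z≤n)) (≰⇒> 4≰n)))

module Knockout {P : Set} (win : P → P → P) (v : P → P → ℕ → ℕ) where

  champion : ∀ r → (Fin (2 ^ r) → P) → P
  champion r f = proj₁ (playBlock win v r f)

  value : ∀ r → (Fin (2 ^ r) → P) → ℕ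
  value r f = proj₂ (playBlock win v r f)

  playBlock-cong : ∀ r {f g : Fin (2 ^ r) → P} → (∀ i → f i ≡ g i) →
                   playBlock win v r f ≡ playBlock win v r g
  playBlock-cong zero    f≗g = cong (_, 0) (f≗g 0F)
  playBlock-cong (suc r) f≗g
    rewrite playBlock-cong r (f≗g ∘ leftHalf r) | playBlock-cong r (f≗g ∘ rightHalf r) = refl

  value-cong : ∀ r {f g : Fin (2 ^ r) → P} → (∀ i → f i ≡ g i) → value r f ≡ value r g
  value-cong r f≗g = cong proj₂ (playBlock-cong r f≗g)

  halves-≤-value : ∀ r (f : Fin (2 ^ suc r) → P) →
                   value r (f ∘ leftHalf r) + value r (f ∘ rightHalf r) ≤ value (suc r) f
  halves-≤-value r f = m≤m+n _ _

  left-game-≤-value : ∀ r (f : Fin (2 ^ suc r) → P) {x} → x ≤ value r (f ∘ leftHalf r) →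
    x + v (champion r (f ∘ leftHalf r)) (champion r (f ∘ rightHalf r)) (suc r) ≤ value (suc r) f
  left-game-≤-value r f x≤ = +-monoˡ-≤ _ (≤-trans x≤ (m≤m+n _ _))

  right-≤-value : ∀ r (f : Fin (2 ^ suc r) → P) {x} → x ≤ value r (f ∘ rightHalf r) →
                  x ≤ value (suc r) f
  right-≤-value r f x≤ = ≤-trans x≤ (≤-trans (m≤n+m _ _) (halves-≤-value r f))

  games-≤-value₄ : (g : Fin 16 → P) →
      v (g (# 0)) (g (# 1)) 1
    + v (win (g (# 0)) (g (# 1))) (win (g (# 2)) (g (# 3))) 2
    + v (win (win (g (# 0)) (g (# 1))) (win (g (# 2)) (g (# 3))))
        (win (win (g (# 4)) (g (# 5))) (win (g (# 6)) (g (# 7)))) 3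
    + v (g (# 14)) (g (# 15)) 1
    ≤ value 4 g
  games-≤-value₄ g = ≤-trans
    (+-mono-≤ (left-game-≤-value 2 (g ∘ leftHalf 3)
                (left-game-≤-value 1 (g ∘ leftHalf 3 ∘ leftHalf 2) ≤-refl))
              (right-≤-value 2 (g ∘ rightHalf 3)
                (right-≤-value 1 (g ∘ rightHalf 3 ∘ rightHalf 2) ≤-refl)))
    (halves-≤-value 3 g)

  blockPos : ∀ s r → Fin (2 ^ s) → Fin (2 ^ r) → Fin (2 ^ (s + r))
  blockPos s r t i = cast (sym (^-distribˡ-+-* 2 s r)) (combine t i)

  toℕ-blockPos : ∀ s r t i → toℕ (blockPos s r t i) ≡ 2 ^ r * toℕ t + toℕ i
  toℕ-blockPos s r t i = trans (FP.toℕ-cast _ (combine t i)) (FP.toℕ-combine t i)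

  ∑-blocks-≤-value : ∀ s r (f : Fin (2 ^ (s + r)) → P) →
                     ∑[ t < 2 ^ s ] value r (f ∘ blockPos s r t) ≤ value (s + r) f
  ∑-blocks-≤-value zero r f = ≤-reflexive (trans (+-identityʳ _) (value-cong r only-block))
    where
    only-block : ∀ i → f (blockPos 0 r 0F i) ≡ f i
    only-block i = cong f (FP.toℕ-injective
      (trans (toℕ-blockPos 0 r 0F i) (cong (_+ toℕ i) (*-zeroʳ (2 ^ r)))))
  ∑-blocks-≤-value (suc s) r f = begin
    ∑[ t < 2 ^ s + (2 ^ s + 0) ] value r (f ∘ blockPos (suc s) r t)
      ≡⟨ ∑-splitAt (2 ^ s) (2 ^ s + 0) _ ⟩
    ∑[ t < 2 ^ s ] value r (f ∘ blockPos (suc s) r (t ↑ˡ _))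
      + ∑[ u < 2 ^ s + 0 ] value r (f ∘ blockPos (suc s) r (2 ^ s ↑ʳ u))
      ≡⟨ cong₂ _+_ (sum-cong-≗ λ t → value-cong r (cong f ∘ left-block t))
                   (trans (∑-splitAt (2 ^ s) 0 _) (+-identityʳ _)) ⟩
    ∑[ t < 2 ^ s ] value r (fL ∘ blockPos s r t)
      + ∑[ t < 2 ^ s ] value r (f ∘ blockPos (suc s) r (2 ^ s ↑ʳ (t ↑ˡ 0)))
      ≡⟨ cong (∑[ t < 2 ^ s ] value r (fL ∘ blockPos s r t) +_)
              (sum-cong-≗ λ t → value-cong r (cong f ∘ right-block t)) ⟩
    ∑[ t < 2 ^ s ] value r (fL ∘ blockPos s r t) + ∑[ t < 2 ^ s ] value r (fR ∘ blockPos s r t)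
      ≤⟨ +-mono-≤ (∑-blocks-≤-value s r fL) (∑-blocks-≤-value s r fR) ⟩
    value (s + r) fL + value (s + r) fR
      ≤⟨ halves-≤-value (s + r) f ⟩
    value (suc s + r) f ∎
    where
    open ≤-Reasoning
    fL fR : Fin (2 ^ (s + r)) → P
    fL = f ∘ leftHalf (s + r)
    fR = f ∘ rightHalf (s + r)
    left-block : ∀ t i → blockPos (suc s) r (t ↑ˡ _) i ≡ leftHalf (s + r) (blockPos s r t i)
    left-block t i = FP.toℕ-injective (begin-equality
      toℕ (blockPos (suc s) r (t ↑ˡ _) i)        ≡⟨ toℕ-blockPos (suc s) r _ i ⟩
      2 ^ r * toℕ (t ↑ˡ _) + toℕ i              ≡⟨ cong (λ x → 2 ^ r * x + toℕ i) (FP.toℕ-↑ˡ t _) ⟩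
      2 ^ r * toℕ t + toℕ i                      ≡⟨ toℕ-blockPos s r t i ⟨
      toℕ (blockPos s r t i)                     ≡⟨ FP.toℕ-↑ˡ _ _ ⟨
      toℕ (leftHalf (s + r) (blockPos s r t i)) ∎)
    right-block : ∀ t i → blockPos (suc s) r (2 ^ s ↑ʳ (t ↑ˡ 0)) i ≡ rightHalf (s + r) (blockPos s r t i)
    right-block t i = FP.toℕ-injective (begin-equality
      toℕ (blockPos (suc s) r (2 ^ s ↑ʳ (t ↑ˡ 0)) i)
        ≡⟨ toℕ-blockPos (suc s) r _ i ⟩
      2 ^ r * toℕ (2 ^ s ↑ʳ (_↑ˡ_ {2 ^ s} t 0)) + toℕ i
        ≡⟨ cong (λ x → 2 ^ r * x + toℕ i)
                (trans (FP.toℕ-↑ʳ (2 ^ s) (t ↑ˡ 0)) (cong (2 ^ s +_) (FP.toℕ-↑ˡ t 0))) ⟩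
      2 ^ r * (2 ^ s + toℕ t) + toℕ i
        ≡⟨ shift (2 ^ s) (2 ^ r) (toℕ t) (toℕ i) ⟩
      2 ^ s * 2 ^ r + (2 ^ r * toℕ t + toℕ i)
        ≡⟨ cong₂ _+_ (^-distribˡ-+-* 2 s r) (toℕ-blockPos s r t i) ⟨
      2 ^ (s + r) + toℕ (blockPos s r t i)
        ≡⟨ cong (2 ^ (s + r) +_) (FP.toℕ-↑ˡ _ 0) ⟨
      2 ^ (s + r) + toℕ (blockPos s r t i ↑ˡ 0)
        ≡⟨ FP.toℕ-↑ʳ (2 ^ (s + r)) _ ⟨
      toℕ (rightHalf (s + r) (blockPos s r t i)) ∎)
      where
      shift : ∀ a b t i → b * (a + t) + i ≡ a * b + (b * t + i)
      shift = solve-∀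

  ∑-blocks₁₆-≤-value : ∀ {n} n' (f : Fin (2 ^ n') → P) (seed : Fin n → Fin 16 → Fin (2 ^ n')) →
    16 * n ≤ 2 ^ n' → (∀ t i → toℕ (seed t i) ≡ 16 * toℕ t + toℕ i) →
    ∑[ t < n ] value 4 (f ∘ seed t) ≤ value n' f
  ∑-blocks₁₆-≤-value {zero}  n' f seed _ _ = z≤n
  ∑-blocks₁₆-≤-value {suc n} n' f seed 16n≤2^n' toℕ-seed
    with s , refl ← 16≤2^n⇒∃[s]s+4≡n n' (≤-trans (*-monoʳ-≤ 16 (s≤s z≤n)) 16n≤2^n') = begin
    ∑[ t < suc n ] value 4 (f ∘ seed t)
      ≡⟨ sum-cong-≗ (λ t → value-cong 4 (cong f ∘ seed≡blockPos t)) ⟩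
    ∑[ t < suc n ] value 4 (f ∘ blockPos s 4 (inject≤ t n≤2^s))
      ≤⟨ ∑-∘-injective-≤ (λ t → inject≤ t n≤2^s) (FP.inject≤-injective _ _ _ _)
                         (λ u → value 4 (f ∘ blockPos s 4 u)) ⟩
    ∑[ u < 2 ^ s ] value 4 (f ∘ blockPos s 4 u)
      ≤⟨ ∑-blocks-≤-value s 4 f ⟩
    value (s + 4) f ∎
    where
    open ≤-Reasoning
    n≤2^s : suc n ≤ 2 ^ s
    n≤2^s = *-cancelˡ-≤ 16 (≤-trans 16n≤2^n'
              (≤-reflexive (trans (^-distribˡ-+-* 2 s 4) (*-comm (2 ^ s) 16))))
    seed≡blockPos : ∀ t i → seed t i ≡ blockPos s 4 (inject≤ t n≤2^s) i
    seed≡blockPos t i = FP.toℕ-injective (begin-equality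
      toℕ (seed t i)                          ≡⟨ toℕ-seed t i ⟩
      16 * toℕ t + toℕ i                      ≡⟨ cong (λ x → 16 * x + toℕ i) (FP.toℕ-inject≤ t n≤2^s) ⟨
      16 * toℕ (inject≤ t n≤2^s) + toℕ i      ≡⟨ toℕ-blockPos s 4 _ i ⟨
      toℕ (blockPos s 4 (inject≤ t n≤2^s) i) ∎)

module Strength {n m d : ℕ} where

  winner-≥ : ∀ (x y : Player n m d) → strength y ≤ strength x → winner x y ≡ x
  winner-≥ x y y≤x with strength y ≤ᵇ strength x | ≤⇒≤ᵇ y≤x
  ... | true | _ = refl

  winner-≤ : ∀ {b} (x y : Player n m d) → strength x ≤ b → strength y ≤ b → strength (winner x y) ≤ b
  winner-≤ x y x≤b y≤b with strength y ≤ᵇ strength x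
  ... | true  = x≤b
  ... | false = y≤b

  dummy-weak : ∀ k → strength (dm {n} {m} {d} k) ≤ d
  dummy-weak k = m∸n≤m d (toℕ k)

  clause-weak : ∀ c → strength (cl {n} {m} {d} c) ≤ d + m
  clause-weak c = +-monoʳ-≤ d (m∸n≤m m (toℕ c))

  clause-wins : ∀ c (Y : Player n m d) → strength Y ≤ d → winner (cl c) Y ≡ cl c
  clause-wins c Y Y≤d = winner-≥ (cl c) Y (≤-trans Y≤d (m≤m+n d _))

  literal : Fin n → Bool → Player n m d
  literal t true  = vT t
  literal t false = vF t

  literal-strong : ∀ t b → d + m < strength (literal t b)
  literal-strong t true  = ≤-<-trans (m≤m+n _ _) (m<m+n _ (s≤s z≤n))
  literal-strong t false = ≤-<-trans (m≤m+n _ _) (m<m+n _ (s≤s z≤n))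

  literal-wins : ∀ t b X → strength X ≤ d + m → winner (literal t b) X ≡ literal t b
  literal-wins t b X X≤ = winner-≥ (literal t b) X (≤-trans X≤ (<⇒≤ (literal-strong t b)))

module Construction {n m n' : ℕ} (φ : Formula n m) (O : AppearanceOrder φ) (a : Assignment n)
                    (16n≤2^n' : 16 * n ≤ 2 ^ n') where
  open AppearanceOrder O

  p d : ℕ
  p = 2 ^ n' ∸ 16 * n
  d = numDummies n m n'

  open Strength {n} {m} {d}

  literalRole : Bool → Fin 3
  literalRole true  = 0F
  literalRole false = 2F

  toRoles : Player n m d → (Fin n × Fin 3) ⊎ (Fin m ⊎ Fin d)
  toRoles (vx t) = inj₁ (t , 1F)
  toRoles (vT t) = inj₁ (t , literalRole (a t))
  toRoles (vF t) = inj₁ (t , literalRole (not (a t)))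
  toRoles (cl c) = inj₂ (inj₁ c)
  toRoles (dm k) = inj₂ (inj₂ k)

  lowPlayer : Fin m ⊎ Fin d → Player n m d
  lowPlayer (inj₁ c) = cl c
  lowPlayer (inj₂ k) = dm k

  fromRoles : (Fin n × Fin 3) ⊎ (Fin m ⊎ Fin d) → Player n m d
  fromRoles (inj₁ (t , 0F)) = literal t (a t)
  fromRoles (inj₁ (t , 1F)) = vx t
  fromRoles (inj₁ (t , 2F)) = literal t (not (a t))
  fromRoles (inj₂ x)        = lowPlayer x

  toRoles∘fromRoles : ∀ x → toRoles (fromRoles x) ≡ x
  toRoles∘fromRoles (inj₁ (t , 0F)) with a t in eq
  ... | true  = cong (λ b → inj₁ (t , literalRole b)) eq
  ... | false = cong (λ b → inj₁ (t , literalRole (not b))) eq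
  toRoles∘fromRoles (inj₁ (t , 1F)) = refl
  toRoles∘fromRoles (inj₁ (t , 2F)) with a t in eq
  ... | true  = cong (λ b → inj₁ (t , literalRole (not b))) eq
  ... | false = cong (λ b → inj₁ (t , literalRole b)) eq
  toRoles∘fromRoles (inj₂ (inj₁ c)) = refl
  toRoles∘fromRoles (inj₂ (inj₂ k)) = refl

  fromRoles∘toRoles : ∀ X → fromRoles (toRoles X) ≡ X
  fromRoles∘toRoles (vx t) = refl
  fromRoles∘toRoles (vT t) with a t in eq
  ... | true  = cong (literal t) eq
  ... | false = cong (literal t ∘ not) eq
  fromRoles∘toRoles (vF t) with a t in eq
  ... | true  = cong (literal t ∘ not) eq
  ... | false = cong (literal t) eq
  fromRoles∘toRoles (cl c) = refl
  fromRoles∘toRoles (dm k) = refl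

  playerRoles : Player n m d ↔ ((Fin n × Fin 3) ⊎ (Fin m ⊎ Fin d))
  playerRoles = mk↔ₛ′ toRoles fromRoles toRoles∘fromRoles fromRoles∘toRoles

  chosenLiteral : Fin m → Fin 2
  chosenLiteral c with a (proj₁ (φ c 0F)) Bool.≟ proj₂ (φ c 0F)
  ... | yes _ = 0F
  ... | no  _ = 1F

  chosenLiteral-satisfied : ∀ c → clauseSat a φ c → litSat a (φ c (chosenLiteral c))
  chosenLiteral-satisfied c (q , sat) with a (proj₁ (φ c 0F)) Bool.≟ proj₂ (φ c 0F) | q
  ... | yes sat₀ | _  = sat₀
  ... | no ¬sat₀ | 0F = contradiction sat ¬sat₀
  ... | no _     | 1F = sat

  slot : Fin m → Fin n × Fin 3
  slot c = occVar φ (c , chosenLiteral c) , rank (c , chosenLiteral c)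

  slot-injective : Injective _≡_ _≡_ slot
  slot-injective {c} {c′} eq =
    cong proj₁ (injective (c , chosenLiteral c) (c′ , chosenLiteral c′) (cong proj₁ eq) (cong proj₂ eq))

  -- Low seat l is gadget seat l + 1; the literal on seat 0 meets seats 1, 2, 4 in rounds 1, 2, 3.
  rankSeat : Fin 3 → Fin 13
  rankSeat 0F = 0F
  rankSeat 1F = 1F
  rankSeat 2F = 3F

  rankSeat-injective : Injective _≡_ _≡_ rankSeat
  rankSeat-injective {0F} {0F} _ = refl
  rankSeat-injective {1F} {1F} _ = refl
  rankSeat-injective {2F} {2F} _ = refl
  rankSeat-injective {0F} {1F} ()
  rankSeat-injective {0F} {2F} ()
  rankSeat-injective {1F} {0F} ()
  rankSeat-injective {1F} {2F} ()
  rankSeat-injective {2F} {0F} ()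
  rankSeat-injective {2F} {1F} ()

  slotSeat : Fin m → Fin n × Fin 13
  slotSeat c = map₂ rankSeat (slot c)

  slotSeat-injective : Injective _≡_ _≡_ slotSeat
  slotSeat-injective eq =
    slot-injective (cong₂ _,_ (cong proj₁ eq) (rankSeat-injective (cong proj₂ eq)))

  lowSeatIndex : Fin (13 * n + p) ↔ ((Fin n × Fin 13) ⊎ Fin p)
  lowSeatIndex = ↔-trans FP.+↔⊎ (↔-trans FP.*↔× (×-comm _ _) ⊎-↔ ↔-refl)

  clauseIndex : Fin m → Fin (13 * n + p)
  clauseIndex c = Inverse.from lowSeatIndex (inj₁ (slotSeat c))

  clauseIndex-injective : Injective _≡_ _≡_ clauseIndex
  clauseIndex-injective =
    slotSeat-injective ∘ inj₁-injective ∘ Injection.injective (↔⇒↣ (↔-sym lowSeatIndex))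

  -- d is by definition 13 * n + p ∸ m: the dummies fill the low seats that no clause takes.
  -- Only lowSeats-clause is used about lowSeats, so it is kept opaque.
  opaque
    lowSeats : (Fin m ⊎ Fin d) ↔ ((Fin n × Fin 13) ⊎ Fin p)
    lowSeats = ↔-trans (↔-sym FP.+↔⊎)
                 (↔-trans (proj₁ (extend-injection clauseIndex clauseIndex-injective)) lowSeatIndex)

  opaque
    unfolding lowSeats
    lowSeats-clause : ∀ c → Inverse.to lowSeats (inj₁ c) ≡ inj₁ (slotSeat c)
    lowSeats-clause c =
      trans (cong (Inverse.to lowSeatIndex) (proj₂ (extend-injection clauseIndex clauseIndex-injective) c))
            (Inverse.strictlyInverseˡ lowSeatIndex _)

  -- Seat 0 gets role 0 (the literal true under a), seats 1–13 the low seats, and seats 14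
  -- and 15 the roles 1 and 2 (the variable player and the other literal).
  gadgetLayout : (Fin 3 ⊎ Fin 13) ↔ Fin 16
  gadgetLayout = ↔-trans (FP.+↔⊎ {1} {2} ⊎-↔ ↔-refl) (↔-trans (⊎-assoc 0ℓ _ _ _)
                   (↔-trans (↔-refl ⊎-↔ ↔-trans (⊎-comm _ _) (↔-sym (FP.+↔⊎ {13} {2})))
                            (↔-sym (FP.+↔⊎ {1} {15}))))

  Seats : Set
  Seats = (Fin n × Fin 16) ⊎ Fin p

  seats : Player n m d ↔ Seats
  seats = ↔-trans playerRoles
          (↔-trans (↔-refl ⊎-↔ lowSeats)
          (↔-trans (↔-sym (⊎-assoc 0ℓ _ _ _))
          (↔-trans (↔-sym (×-distribˡ-⊎ 0ℓ _ _ _) ⊎-↔ ↔-refl)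
                   ((↔-refl ×-↔ gadgetLayout) ⊎-↔ ↔-refl))))

  seatCount : n * 16 + p ≡ 2 ^ n'
  seatCount = trans (cong (_+ p) (*-comm n 16)) (m+[n∸m]≡n 16n≤2^n')

  positions : Seats ↔ Fin (2 ^ n')
  positions = ↔-trans (↔-sym FP.*↔× ⊎-↔ ↔-refl) (↔-trans (↔-sym FP.+↔⊎) (Perm.cast-id seatCount))

  seeding : Seeding n m n'
  seeding = ↔-trans seats positions

  gadget : Fin n → Fin 16 → Player n m d
  gadget t i = Inverse.from seats (inj₁ (t , i))

  gadgetSeed : Fin n → Fin 16 → Fin (2 ^ n')
  gadgetSeed t i = Inverse.to positions (inj₁ (t , i))

  toℕ-gadgetSeed : ∀ t i → toℕ (gadgetSeed t i) ≡ 16 * toℕ t + toℕ i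
  toℕ-gadgetSeed t i =
    trans (FP.toℕ-cast _ _) (trans (FP.toℕ-↑ˡ (combine t i) p) (FP.toℕ-combine t i))

  seeding⁻¹-gadgetSeed : ∀ t i → Inverse.from seeding (gadgetSeed t i) ≡ gadget t i
  seeding⁻¹-gadgetSeed t i = cong (Inverse.from seats) (Inverse.strictlyInverseʳ positions (inj₁ (t , i)))

  occupant : Fin n × Fin 13 → Fin m ⊎ Fin d
  occupant s = Inverse.from lowSeats (inj₁ s)

  low : Fin n → Fin 13 → Player n m d
  low t l = lowPlayer (occupant (t , l))

  occupant-slotSeat : ∀ c → occupant (slotSeat c) ≡ inj₁ c
  occupant-slotSeat c = trans (cong (Inverse.from lowSeats) (sym (lowSeats-clause c)))
                              (Inverse.strictlyInverseʳ lowSeats (inj₁ c))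

  occupant≡clause⇒slotSeat : ∀ {s c} → occupant s ≡ inj₁ c → s ≡ slotSeat c
  occupant≡clause⇒slotSeat {s} {c} eq = inj₁-injective (begin
    inj₁ s                           ≡⟨ Inverse.strictlyInverseˡ lowSeats (inj₁ s) ⟨
    Inverse.to lowSeats (occupant s) ≡⟨ cong (Inverse.to lowSeats) eq ⟩
    Inverse.to lowSeats (inj₁ c)     ≡⟨ lowSeats-clause c ⟩
    inj₁ (slotSeat c)                ∎)
    where open ≡-Reasoning

  low-weak : ∀ t l → strength (low t l) ≤ d + m
  low-weak t l with occupant (t , l)
  ... | inj₁ c = clause-weak c
  ... | inj₂ k = ≤-trans (dummy-weak k) (m≤m+n d m)

  filler-weak : ∀ t l → (∀ j → rankSeat j ≢ l) → strength (low t l) ≤ d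
  filler-weak t l not-slot with occupant (t , l) in eq
  ... | inj₁ c = contradiction (sym (cong proj₂ (occupant≡clause⇒slotSeat eq))) (not-slot _)
  ... | inj₂ k = dummy-weak k

  slot-occupant-wins : ∀ {t l c} Y → occupant (t , l) ≡ inj₁ c → strength Y ≤ d →
                       winner (low t l) Y ≡ cl c
  slot-occupant-wins {c = c} Y eq Y≤d rewrite eq = clause-wins c Y Y≤d

  literal-champion : ∀ t b →
    winner (winner (literal t b) (low t 0F)) (winner (low t 1F) (low t 2F)) ≡ literal t b
  literal-champion t b = trans
    (cong (λ Z → winner Z (winner (low t 1F) (low t 2F))) (literal-wins t b (low t 0F) (low-weak t 0F)))
    (literal-wins t b (winner (low t 1F) (low t 2F))
                      (winner-≤ (low t 1F) (low t 2F) (low-weak t 1F) (low-weak t 2F)))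

  pair-champion : ∀ {t c} → occupant (t , 1F) ≡ inj₁ c → winner (low t 1F) (low t 2F) ≡ cl c
  pair-champion {t} eq = slot-occupant-wins (low t 2F) eq (filler-weak t 2F λ { 0F () ; 1F () ; 2F () })

  quad-champion : ∀ {t c} → occupant (t , 3F) ≡ inj₁ c →
                  winner (winner (low t 3F) (low t 4F)) (winner (low t 5F) (low t 6F)) ≡ cl c
  quad-champion {t} {c} eq = begin
    winner (winner (low t 3F) (low t 4F)) (winner (low t 5F) (low t 6F))
      ≡⟨ cong (λ Z → winner Z (winner (low t 5F) (low t 6F)))
              (slot-occupant-wins (low t 4F) eq (filler-weak t 4F λ { 0F () ; 1F () ; 2F () })) ⟩
    winner (cl c) (winner (low t 5F) (low t 6F))
      ≡⟨ clause-wins c (winner (low t 5F) (low t 6F))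
           (winner-≤ (low t 5F) (low t 6F) (filler-weak t 5F λ { 0F () ; 1F () ; 2F () })
                                           (filler-weak t 6F λ { 0F () ; 1F () ; 2F () })) ⟩
    cl c ∎
    where open ≡-Reasoning

  gv : Player n m d → Player n m d → ℕ → ℕ
  gv = gameValue φ O

  literal-meets-clause : ∀ t b c r → (∃ λ q → φ c q ≡ (t , b) × suc (toℕ (rank (c , q))) ≡ r) →
                         gv (literal t b) (cl c) r ≡ 1
  literal-meets-clause t true  c r = indicator-yes (clauseApp? φ O c t true r)
  literal-meets-clause t false c r = indicator-yes (clauseApp? φ O c t false r)

  variable-meets-literal : ∀ t b → gv (vx t) (literal t b) 1 ≡ 1
  variable-meets-literal t true  = indicator-yes (t FP.≟ t) refl
  variable-meets-literal t false = indicator-yes (t FP.≟ t) refl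

  credit : Fin m ⊎ Fin d → ℕ
  credit (inj₁ c) = [ clauseSat? a φ c ]
  credit (inj₂ _) = 0

  slotCredit : Fin n → Fin 3 → ℕ
  slotCredit t j = credit (occupant (t , rankSeat j))

  clauseCredit-≤-game : ∀ c → let (t , j) = slot c in
                        [ clauseSat? a φ c ] ≤ gv (literal t (a t)) (cl c) (suc (toℕ j))
  clauseCredit-≤-game c with clauseSat? a φ c
  ... | no  _   = z≤n
  ... | yes sat = ≤-reflexive (sym (literal-meets-clause t (a t) c (suc (toℕ j))
                    (chosenLiteral c , cong (t ,_) (sym (chosenLiteral-satisfied c sat)) , refl)))
    where
    t = proj₁ (slot c)
    j = proj₂ (slot c)

  slotCredit-≤-game : ∀ t j {Z X} → Z ≡ literal t (a t) →
                      (∀ {c} → occupant (t , rankSeat j) ≡ inj₁ c → X ≡ cl c) →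
                      slotCredit t j ≤ gv Z X (suc (toℕ j))
  slotCredit-≤-game t j refl X≡ with occupant (t , rankSeat j) in eq
  ... | inj₂ _ = z≤n
  ... | inj₁ c rewrite X≡ refl =
    subst₂ (λ t′ j′ → [ clauseSat? a φ c ] ≤ gv (literal t′ (a t′)) (cl c) (suc (toℕ j′)))
           (sym (cong proj₁ seat≡)) (sym (rankSeat-injective (cong proj₂ seat≡))) (clauseCredit-≤-game c)
    where
    seat≡ : (t , rankSeat j) ≡ slotSeat c
    seat≡ = occupant≡clause⇒slotSeat eq

  open Knockout winner gv

  gadget-value : ∀ t → ∑[ j < 3 ] slotCredit t j + 1 ≤ value 4 (gadget t)
  gadget-value t = begin
    ∑[ j < 3 ] slotCredit t j + 1
      ≡⟨ cong (_+ 1) (∑₃ (slotCredit t)) ⟩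
    slotCredit t 0F + slotCredit t 1F + slotCredit t 2F + 1
      ≤⟨ +-mono-≤ (+-mono-≤ (+-mono-≤ game₁ game₂) game₃) game₄ ⟩
    _
      ≤⟨ games-≤-value₄ (gadget t) ⟩
    value 4 (gadget t) ∎
    where
    open ≤-Reasoning
    L : Player n m d
    L = literal t (a t)
    ∑₃ : ∀ f → ∑[ j < 3 ] f j ≡ f 0F + f 1F + f 2F
    ∑₃ f = trans (cong (λ x → f 0F + (f 1F + x)) (+-identityʳ (f 2F))) (sym (+-assoc (f 0F) _ _))
    game₁ : slotCredit t 0F ≤ gv L (low t 0F) 1
    game₁ = slotCredit-≤-game t 0F refl (cong lowPlayer)
    game₂ : slotCredit t 1F ≤ gv (winner L (low t 0F)) (winner (low t 1F) (low t 2F)) 2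
    game₂ = slotCredit-≤-game t 1F (literal-wins t (a t) (low t 0F) (low-weak t 0F)) pair-champion
    game₃ : slotCredit t 2F ≤ gv (winner (winner L (low t 0F)) (winner (low t 1F) (low t 2F)))
                                 (winner (winner (low t 3F) (low t 4F)) (winner (low t 5F) (low t 6F))) 3
    game₃ = slotCredit-≤-game t 2F (literal-champion t (a t)) quad-champion
    game₄ : 1 ≤ gv (vx t) (literal t (not (a t))) 1
    game₄ = ≤-reflexive (sym (variable-meets-literal t (not (a t))))

  numSat≤∑slotCredit : numSat a φ ≤ ∑[ t < n ] ∑[ j < 3 ] slotCredit t j
  numSat≤∑slotCredit = begin
    numSat a φ                            ≡⟨ length-filter-tabulate (clauseSat? a φ) id ⟩
    ∑[ c < m ] [ clauseSat? a φ c ]       ≡⟨ sum-cong-≗ credit-at-slot ⟩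
    ∑[ c < m ] h (slotIndex c)            ≤⟨ ∑-∘-injective-≤ slotIndex slotIndex-injective h ⟩
    ∑[ k < n * 3 ] h k                    ≡⟨ ∑-combine n 3 h ⟩
    ∑[ t < n ] ∑[ j < 3 ] h (combine t j) ≡⟨ sum-cong-≗ (λ t → sum-cong-≗ (h-combine t)) ⟩
    ∑[ t < n ] ∑[ j < 3 ] slotCredit t j  ∎
    where
    open ≤-Reasoning
    h : Fin (n * 3) → ℕ
    h = uncurry slotCredit ∘ Inverse.to FP.*↔×
    h-combine : ∀ t j → h (combine t j) ≡ slotCredit t j
    h-combine t j = cong (uncurry slotCredit) (FP.remQuot-combine t j)
    slotIndex : Fin m → Fin (n * 3)
    slotIndex = uncurry combine ∘ slot
    slotIndex-injective : Injective _≡_ _≡_ slotIndex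
    slotIndex-injective eq = slot-injective (uncurry (cong₂ _,_) (FP.combine-injective _ _ _ _ eq))
    credit-at-slot : ∀ c → [ clauseSat? a φ c ] ≡ h (slotIndex c)
    credit-at-slot c = sym (trans (h-combine _ _) (cong credit (occupant-slotSeat c)))

  numSat+n≤value : numSat a φ + n ≤ tournamentValue n' φ O seeding
  numSat+n≤value = begin
    numSat a φ + n
      ≤⟨ +-mono-≤ numSat≤∑slotCredit (≤-reflexive (sym (∑-ones n))) ⟩
    ∑[ t < n ] ∑[ j < 3 ] slotCredit t j + ∑[ t < n ] 1
      ≡⟨ ∑-distrib-+ (λ t → ∑[ j < 3 ] slotCredit t j) (λ _ → 1) ⟨
    ∑[ t < n ] (∑[ j < 3 ] slotCredit t j + 1)
      ≤⟨ ∑-mono-≤ gadget-value ⟩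
    ∑[ t < n ] value 4 (gadget t)
      ≡⟨ sum-cong-≗ (λ t → value-cong 4 (seeding⁻¹-gadgetSeed t)) ⟨
    ∑[ t < n ] value 4 (Inverse.from seeding ∘ gadgetSeed t)
      ≤⟨ ∑-blocks₁₆-≤-value n' (Inverse.from seeding) gadgetSeed 16n≤2^n' toℕ-gadgetSeed ⟩
    value n' (Inverse.from seeding) ∎
    where open ≤-Reasoning

lemma1 : (n m n' k : ℕ) (φ : Formula n m) → IsMax23 φ →
    (O : AppearanceOrder φ) → IsRoundCount n n' →
    (Σ (Assignment n) λ a → k ≤ numSat a φ) →
    Σ (Seeding n m n') λ σ → k + n ≤ tournamentValue n' φ O σ
lemma1 n m n' k φ _ O (16n≤2^n' , _) (a , k≤numSat) =
  seeding , ≤-trans (+-monoˡ-≤ n k≤numSat) numSat+n≤value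
  where open Construction {n' = n'} φ O a 16n≤2^n'
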